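{- Let $a=(a_1,\dots,a_n)$ be a sequence of positive integers, let $I$ be a non-empty subset of $\{1,2,\dots,n\}$ and let $J$ be a non-empty subset of $I$. Then \[ \sum_{i\in J}(-1)^{|J\setminus\{i\}|+1}\,q^{\sum_{j=i+1}^n a_j+L_{I\setminus\{i\},J\setminus\{i\}}(a^{(i)})}\,(1-q^{a_i}) =(-1)^{|J|}\,q^{L_{I,J}(a)}\,(1-q^{a_J}). \]
   Context: $q$ is an indeterminate; $|S|$ is the number of elements of a set $S$ and $a_S:=\sum_{j\in S}a_j$. For $I,J\subseteq\{1,\dots,n\}$, $L_{I,J}(a):=\sum_{1\le u\le v\le n,\ u\in I,\ v\notin J} a_v$. The sequence $a^{(i)}$ is $a$ with the entry $a_i$ deleted, its entries keeping their original indices in $\{1,\dots,n\}\setminus\{i\}$; accordingly, for $I',J'\subseteq\{1,\dots,n\}\setminus\{i\}$, $L_{I',J'}(a^{(i)}):=\sum a_v$ over pairs $u\le v$ with $u,v\ne i$, $u\in I'$, $v\notin J'$. -}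

module Defs where

open import Level using (Level)
import Data.Nat as N
open import Data.Nat using (ℕ; zero; suc; _<ᵇ_; _≤ᵇ_; _≡ᵇ_)
open import Data.Bool using (Bool; true; false; if_then_else_; _∧_; not)
open import Data.Fin using (Fin; toℕ)
open import Data.Fin.Subset using (Subset)
import Data.Fin.Subset as S
open import Data.Vec using (lookup)
open import Algebra.Bundles using (CommutativeRing; Semiring)
import Algebra.Definitions.RawSemiring as RS

sumℕ : ∀ {n} → (Fin n → ℕ) → ℕ
sumℕ {zero}  f = 0
sumℕ {suc n} f = f Fin.zero N.+ sumℕ (λ i → f (Fin.suc i))
  where import Data.Fin as Fin

[_]·_ : Bool → ℕ → ℕ
[ b ]· x = if b then x else 0

aSum : ∀ {n} → (Fin n → ℕ) → Subset n → ℕ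
aSum a S = sumℕ (λ j → [ lookup S j ]· a j)

tailSum : ∀ {n} → (Fin n → ℕ) → Fin n → ℕ
tailSum a i = sumℕ (λ j → [ toℕ i <ᵇ toℕ j ]· a j)

L : ∀ {n} → Subset n → Subset n → (Fin n → ℕ) → ℕ
L I J a = sumℕ (λ u → sumℕ (λ v →
  [ (toℕ u ≤ᵇ toℕ v) ∧ lookup I u ∧ not (lookup J v) ]· a v))

-- L_{I',J'}(a^{(i)}): the same sum over pairs u ≤ v with u ≠ i and v ≠ i
-- (a^{(i)} keeps the original indices of a, entry i deleted)
Ldel : ∀ {n} → Fin n → Subset n → Subset n → (Fin n → ℕ) → ℕ
Ldel i I J a = sumℕ (λ u → sumℕ (λ v →
  [ not (toℕ u ≡ᵇ toℕ i) ∧ not (toℕ v ≡ᵇ toℕ i)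
    ∧ (toℕ u ≤ᵇ toℕ v) ∧ lookup I u ∧ not (lookup J v) ]· a v))

module _ {c ℓ : Level} (R : CommutativeRing c ℓ) where
  open CommutativeRing R
  open RS (Semiring.rawSemiring semiring) using (_^_)

  sumR : ∀ {n} → (Fin n → Carrier) → Carrier
  sumR {zero}  f = 0#
  sumR {suc n} f = f Fin.zero + sumR (λ i → f (Fin.suc i))
    where import Data.Fin as Fin

  sumOver : ∀ {n} → Subset n → (Fin n → Carrier) → Carrier
  sumOver J f = sumR (λ i → if lookup J i then f i else 0#)

  sgn : ℕ → Carrier
  sgn k = (- 1#) ^ k

  lhs53 : ∀ {n} → (Fin n → ℕ) → Subset n → Subset n → Carrier → Carrier
  lhs53 a I J q = sumOver J (λ i →
      sgn (S.∣ J S.- i ∣ N.+ 1)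
    * (q ^ (tailSum a i N.+ Ldel i (I S.- i) (J S.- i) a))
    * (1# - q ^ a i))

  rhs53 : ∀ {n} → (Fin n → ℕ) → Subset n → Subset n → Carrier → Carrier
  rhs53 a I J q = sgn S.∣ J ∣ * (q ^ L I J a) * (1# - q ^ aSum a J)

-- Write a_{J>i} = Σ_{v ∈ J, v > i} a_v.  The proof has two independent parts.
--
--  * Exponent shift (a statement about natural numbers): for i ∈ J ⊆ I,
--      Σ_{j>i} a_j + L_{I∖i,J∖i}(a^{(i)}) = L_{I,J}(a) + a_{J>i}.
--    Comparing both sides as double sums over pairs (u,v), the summands
--    agree except in the row u = i, where the left side contributes
--    a_v for v > i and the right side a_v for v ≥ i, v ∉ J.
--  * Telescoping (a statement about commutative rings):
--      Σ_{i ∈ J} q^{a_{J>i}} (1 - q^{a_i}) = 1 - q^{a_J},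
--    by induction on n, peeling off the first index.
--
-- Since moreover |J ∖ i| + 1 = |J|, each summand of the left-hand side is
-- (-1)^|J| q^{L_{I,J}(a)} times the corresponding summand of the telescoping
-- sum, and the theorem follows.

module Submission where

open import Defs
open import Level using (Level)
open import Data.Nat using (ℕ; zero; suc; _<_; _<ᵇ_; _≤ᵇ_; _≡ᵇ_)
import Data.Nat as Nat
open import Data.Bool using (Bool; true; false; if_then_else_; _∧_; not)
open import Data.Bool.Properties using (∧-zeroʳ)
open import Data.Fin using (Fin; toℕ; _≟_) renaming (zero to fzero; suc to fsuc)
open import Data.Fin.Subset using (Subset; _⊆_; Nonempty; ∣_∣) renaming (_-_ to _∖_)
open import Data.Fin.Subset.Properties using (p─⊥≡p)
open import Data.Vec using ([]; _∷_; lookup)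
open import Data.Vec.Properties using (lookup⇒[]=; []=⇒lookup)
open import Relation.Nullary using (¬_; yes; no)
open import Relation.Binary.PropositionalEquality
  using (_≡_; refl; sym; trans; cong; cong₂; module ≡-Reasoning)
open import Algebra.Bundles using (CommutativeRing; Semiring)
import Algebra.Definitions.RawSemiring as RawSemiring
import Algebra.Properties.Semiring.Exp as SemiringExp
import Algebra.Properties.Ring as RingProperties
import Relation.Binary.Reasoning.Setoid as SetoidReasoning

-- Facts about natural numbers, in a module of their own so that ℕ-addition
-- does not clash with ring addition below.
module _ where
  open Nat using (_+_)
  open import Data.Nat.Properties using (+-identityʳ; +-comm; +-commutativeSemigroup)
  open import Algebra.Properties.CommutativeSemigroup +-commutativeSemigroup
    using (interchange)

  sumℕ-cong : ∀ {n} {f g : Fin n → ℕ} → (∀ i → f i ≡ g i) → sumℕ f ≡ sumℕ g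
  sumℕ-cong {zero}  f≗g = refl
  sumℕ-cong {suc n} f≗g = cong₂ _+_ (f≗g fzero) (sumℕ-cong (λ i → f≗g (fsuc i)))

  sumℕ-+ : ∀ {n} (f g : Fin n → ℕ) → sumℕ (λ i → f i + g i) ≡ sumℕ f + sumℕ g
  sumℕ-+ {zero}  f g = refl
  sumℕ-+ {suc n} f g = begin
      (f fzero + g fzero) + sumℕ (λ i → f (fsuc i) + g (fsuc i))
    ≡⟨ cong ((f fzero + g fzero) +_) (sumℕ-+ (λ i → f (fsuc i)) (λ i → g (fsuc i))) ⟩
      (f fzero + g fzero) + (F + G)
    ≡⟨ interchange (f fzero) (g fzero) F G ⟩
      (f fzero + F) + (g fzero + G) ∎
    where
    open ≡-Reasoning
    F G : ℕ
    F = sumℕ (λ i → f (fsuc i))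
    G = sumℕ (λ i → g (fsuc i))

  sumℕ-zero : ∀ n → sumℕ {n} (λ _ → 0) ≡ 0
  sumℕ-zero zero    = refl
  sumℕ-zero (suc n) = sumℕ-zero n

  indicator-sumℕ : ∀ {n} b (f : Fin n → ℕ) → [ b ]· sumℕ f ≡ sumℕ (λ i → [ b ]· f i)
  indicator-sumℕ     true  f = refl
  indicator-sumℕ {n} false f = sym (sumℕ-zero n)

  sumℕ-delta : ∀ {n} (i : Fin n) c → sumℕ {n} (λ u → [ toℕ u ≡ᵇ toℕ i ]· c) ≡ c
  sumℕ-delta {suc n} fzero    c = trans (cong (c +_) (sumℕ-zero n)) (+-identityʳ c)
  sumℕ-delta {suc n} (fsuc i) c = sumℕ-delta i c

  sum₂ : ∀ {n} → (Fin n → Fin n → ℕ) → ℕ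
  sum₂ f = sumℕ (λ u → sumℕ (f u))

  sum₂-cong : ∀ {n} {f g : Fin n → Fin n → ℕ} → (∀ u v → f u v ≡ g u v) → sum₂ f ≡ sum₂ g
  sum₂-cong f≗g = sumℕ-cong (λ u → sumℕ-cong (f≗g u))

  sum₂-+ : ∀ {n} (f g : Fin n → Fin n → ℕ) →
    sum₂ {n} (λ u v → f u v + g u v) ≡ sum₂ f + sum₂ g
  sum₂-+ f g = trans (sumℕ-cong (λ u → sumℕ-+ (f u) (g u)))
                     (sumℕ-+ (λ u → sumℕ (f u)) (λ u → sumℕ (g u)))

  sum₂-row : ∀ {n} (i : Fin n) (t : Fin n → ℕ) →
    sum₂ {n} (λ u v → [ toℕ u ≡ᵇ toℕ i ]· t v) ≡ sumℕ t
  sum₂-row {n} i t =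
    trans (sumℕ-cong {n} (λ u → sym (indicator-sumℕ (toℕ u ≡ᵇ toℕ i) t)))
          (sumℕ-delta i (sumℕ t))

  indicator-split : ∀ b c x → [ b ]· x ≡ [ b ∧ not c ]· x + [ b ]· ([ c ]· x)
  indicator-split false c     x = refl
  indicator-split true  false x = sym (+-identityʳ x)
  indicator-split true  true  x = refl

  ≡ᵇ-refl : ∀ m → (m ≡ᵇ m) ≡ true
  ≡ᵇ-refl zero    = refl
  ≡ᵇ-refl (suc m) = ≡ᵇ-refl m

  <ᵇ-irrefl : ∀ m → (m <ᵇ m) ≡ false
  <ᵇ-irrefl zero    = refl
  <ᵇ-irrefl (suc m) = <ᵇ-irrefl m

  ≤ᵇ-refl : ∀ m → (m ≤ᵇ m) ≡ true
  ≤ᵇ-refl zero    = refl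
  ≤ᵇ-refl (suc m) = <ᵇ-suc m
    where
    <ᵇ-suc : ∀ m → (m <ᵇ suc m) ≡ true
    <ᵇ-suc zero    = refl
    <ᵇ-suc (suc m) = <ᵇ-suc m

  ≢⇒≡ᵇ-false : ∀ {n} (u i : Fin n) → ¬ u ≡ i → (toℕ u ≡ᵇ toℕ i) ≡ false
  ≢⇒≡ᵇ-false fzero    fzero    u≢i with () ← u≢i refl
  ≢⇒≡ᵇ-false fzero    (fsuc i) u≢i = refl
  ≢⇒≡ᵇ-false (fsuc u) fzero    u≢i = refl
  ≢⇒≡ᵇ-false (fsuc u) (fsuc i) u≢i = ≢⇒≡ᵇ-false u i (λ u≡i → u≢i (cong fsuc u≡i))

  ≤ᵇ-distinct : ∀ m k → (k ≡ᵇ m) ≡ false → (m ≤ᵇ k) ≡ (m <ᵇ k)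
  ≤ᵇ-distinct zero    zero    ()
  ≤ᵇ-distinct zero    (suc k) _   = refl
  ≤ᵇ-distinct (suc m) zero    _   = refl
  ≤ᵇ-distinct (suc m) (suc k) k≢m = <ᵇ-suc-distinct m k k≢m
    where
    <ᵇ-suc-distinct : ∀ m k → (k ≡ᵇ m) ≡ false → (m <ᵇ suc k) ≡ (m <ᵇ k)
    <ᵇ-suc-distinct zero    zero    ()
    <ᵇ-suc-distinct zero    (suc k) _   = refl
    <ᵇ-suc-distinct (suc m) zero    _   = refl
    <ᵇ-suc-distinct (suc m) (suc k) k≢m = <ᵇ-suc-distinct m k k≢m

  lookup-remove-other : ∀ {n} (p : Subset n) {u i : Fin n} → ¬ u ≡ i →
    lookup (p ∖ i) u ≡ lookup p u
  lookup-remove-other (x ∷ p) {fzero}  {fzero}  u≢i with () ← u≢i refl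
  lookup-remove-other (x ∷ p) {fzero}  {fsuc i} u≢i = refl
  lookup-remove-other (x ∷ p) {fsuc u} {fzero}  u≢i = cong (λ r → lookup r u) (p─⊥≡p p)
  lookup-remove-other (x ∷ p) {fsuc u} {fsuc i} u≢i =
    lookup-remove-other p (λ u≡i → u≢i (cong fsuc u≡i))

  ∣remove∣+1 : ∀ {n} (p : Subset n) (i : Fin n) → lookup p i ≡ true → ∣ p ∖ i ∣ + 1 ≡ ∣ p ∣
  ∣remove∣+1 (true  ∷ p) fzero    _   = trans (+-comm _ 1) (cong (λ r → suc ∣ r ∣) (p─⊥≡p p))
  ∣remove∣+1 (true  ∷ p) (fsuc i) i∈p = cong suc (∣remove∣+1 p i i∈p)
  ∣remove∣+1 (false ∷ p) (fsuc i) i∈p = ∣remove∣+1 p i i∈p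

  ⊆-lookup : ∀ {n} {J I : Subset n} → J ⊆ I → ∀ i → lookup J i ≡ true → lookup I i ≡ true
  ⊆-lookup {J = J} J⊆I i i∈J = []=⇒lookup (J⊆I (lookup⇒[]= i J i∈J))

  laterSum : ∀ {n} → Subset n → (Fin n → ℕ) → Fin n → ℕ
  laterSum J a i = sumℕ (λ v → [ toℕ i <ᵇ toℕ v ]· ([ lookup J v ]· a v))

  module ExponentShift {n} (a : Fin n → ℕ) (I J : Subset n) (i : Fin n)
                       (i∈J : lookup J i ≡ true) (i∈I : lookup I i ≡ true) where

    row : Fin n → Bool
    row u = toℕ u ≡ᵇ toℕ i

    later later∈J : Fin n → ℕ
    later   v = [ toℕ i <ᵇ toℕ v ]· a v
    later∈J v = [ toℕ i <ᵇ toℕ v ]· ([ lookup J v ]· a v)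

    deleted full : Fin n → Fin n → ℕ
    deleted u v = [ not (row u) ∧ not (row v)
      ∧ (toℕ u ≤ᵇ toℕ v) ∧ lookup (I ∖ i) u ∧ not (lookup (J ∖ i) v) ]· a v
    full u v = [ (toℕ u ≤ᵇ toℕ v) ∧ lookup I u ∧ not (lookup J v) ]· a v

    -- Outside row and column i the two L-summands agree; in row i the
    -- terms v > i of the tail sum split into those with v ∉ J (in L_{I,J})
    -- and those with v ∈ J (in a_{J>i}); column i contributes nothing to
    -- either side because i ∈ J.
    summands : ∀ u v → [ row u ]· later v + deleted u v ≡ full u v + [ row u ]· later∈J v
    summands u v with u ≟ i | v ≟ i
    ... | yes refl | yes refl
      rewrite ≡ᵇ-refl (toℕ u) | <ᵇ-irrefl (toℕ u) | ≤ᵇ-refl (toℕ u) | i∈I | i∈J = refl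
    ... | yes refl | no v≢i
      rewrite ≡ᵇ-refl (toℕ u) | i∈I
            | ≤ᵇ-distinct (toℕ u) (toℕ v) (≢⇒≡ᵇ-false v u v≢i) =
      trans (+-identityʳ _) (indicator-split (toℕ u <ᵇ toℕ v) (lookup J v) (a v))
    ... | no u≢i | yes refl
      rewrite ≢⇒≡ᵇ-false u v u≢i | ≡ᵇ-refl (toℕ v) | i∈J
            | ∧-zeroʳ (lookup I u) | ∧-zeroʳ (toℕ u ≤ᵇ toℕ v) = refl
    ... | no u≢i | no v≢i
      rewrite ≢⇒≡ᵇ-false u i u≢i | ≢⇒≡ᵇ-false v i v≢i
            | lookup-remove-other I u≢i | lookup-remove-other J v≢i = sym (+-identityʳ _)

    shift : tailSum a i + Ldel i (I ∖ i) (J ∖ i) a ≡ L I J a + laterSum J a i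
    shift = begin
        tailSum a i + Ldel i (I ∖ i) (J ∖ i) a
      ≡⟨ cong (_+ sum₂ deleted) (sym (sum₂-row i later)) ⟩
        sum₂ (λ u v → [ row u ]· later v) + sum₂ deleted
      ≡⟨ sym (sum₂-+ {n} _ _) ⟩
        sum₂ (λ u v → [ row u ]· later v + deleted u v)
      ≡⟨ sum₂-cong summands ⟩
        sum₂ (λ u v → full u v + [ row u ]· later∈J v)
      ≡⟨ sum₂-+ {n} _ _ ⟩
        L I J a + sum₂ (λ u v → [ row u ]· later∈J v)
      ≡⟨ cong (L I J a +_) (sum₂-row i later∈J) ⟩
        L I J a + laterSum J a i ∎
      where open ≡-Reasoning

  open ExponentShift public using (shift)

module _ {c ℓ : Level} (R : CommutativeRing c ℓ) where
  open CommutativeRing R hiding (zero) renaming (refl to ≈-refl; sym to ≈-sym; trans to ≈-trans)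
  open RawSemiring (Semiring.rawSemiring semiring) using (_^_)
  open SemiringExp semiring using (^-homo-*)
  open RingProperties ring using (-‿distribʳ-*)
  open SetoidReasoning setoid

  sumR-cong : ∀ {n} {f g : Fin n → Carrier} → (∀ i → f i ≈ g i) → sumR R f ≈ sumR R g
  sumR-cong {zero}  f≈g = ≈-refl
  sumR-cong {suc n} f≈g = +-cong (f≈g fzero) (sumR-cong (λ i → f≈g (fsuc i)))

  sumR-scale : ∀ {n} (k : Carrier) (f : Fin n → Carrier) →
    sumR R (λ i → k * f i) ≈ k * sumR R f
  sumR-scale {zero}  k f = ≈-sym (zeroʳ k)
  sumR-scale {suc n} k f =
    ≈-trans (+-congˡ (sumR-scale k (λ i → f (fsuc i)))) (≈-sym (distribˡ k _ _))

  sumOver-factor : ∀ {n} (J : Subset n) (k : Carrier) (f g : Fin n → Carrier) →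
    (∀ i → lookup J i ≡ true → f i ≈ k * g i) →
    sumOver R J f ≈ k * sumOver R J g
  sumOver-factor J k f g f≈kg =
    ≈-trans (sumR-cong termwise) (sumR-scale k (λ i → if lookup J i then g i else 0#))
    where
    termwise : ∀ i → (if lookup J i then f i else 0#) ≈ k * (if lookup J i then g i else 0#)
    termwise i with lookup J i in i∈J
    ... | true  = f≈kg i i∈J
    ... | false = ≈-sym (zeroʳ k)

  telescope-step : ∀ x y → x * (1# - y) + (1# - x) ≈ 1# - y * x
  telescope-step x y = begin
      x * (1# - y) + (1# - x)
    ≈⟨ +-congʳ (distribˡ x 1# (- y)) ⟩
      (x * 1# + x * - y) + (1# - x)
    ≈⟨ +-congʳ (+-cong (*-identityʳ x) (≈-sym (-‿distribʳ-* x y))) ⟩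
      (x - x * y) + (1# - x)
    ≈⟨ +-comm _ _ ⟩
      (1# - x) + (x - x * y)
    ≈⟨ +-assoc 1# (- x) _ ⟩
      1# + (- x + (x - x * y))
    ≈⟨ +-congˡ (≈-sym (+-assoc (- x) x _)) ⟩
      1# + ((- x + x) - x * y)
    ≈⟨ +-congˡ (≈-trans (+-congʳ (-‿inverseˡ x)) (+-identityˡ _)) ⟩
      1# - x * y
    ≈⟨ +-congˡ (-‿cong (*-comm x y)) ⟩
      1# - y * x ∎

  telescope : ∀ (q : Carrier) n (J : Subset n) (a : Fin n → ℕ) →
    sumOver R J (λ i → q ^ laterSum J a i * (1# - q ^ a i)) ≈ 1# - q ^ aSum a J
  telescope q zero    []          a = ≈-sym (-‿inverseʳ 1#)
  telescope q (suc n) (false ∷ J) a =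
    ≈-trans (+-identityˡ _) (telescope q n J (λ i → a (fsuc i)))
  telescope q (suc n) (true ∷ J)  a = begin
      q ^ aJ′ * (1# - q ^ a fzero) + _
    ≈⟨ +-congˡ (telescope q n J (λ i → a (fsuc i))) ⟩
      q ^ aJ′ * (1# - q ^ a fzero) + (1# - q ^ aJ′)
    ≈⟨ telescope-step _ _ ⟩
      1# - q ^ a fzero * q ^ aJ′
    ≈⟨ +-congˡ (-‿cong (≈-sym (^-homo-* q (a fzero) aJ′))) ⟩
      1# - q ^ (a fzero Nat.+ aJ′) ∎
    where
    aJ′ : ℕ
    aJ′ = aSum (λ i → a (fsuc i)) J

  summand-factor : ∀ (q : Carrier) {n} (a : Fin n → ℕ) (I J : Subset n) → J ⊆ I →
    ∀ i → lookup J i ≡ true →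
    sgn R (∣ J ∖ i ∣ Nat.+ 1) * q ^ (tailSum a i Nat.+ Ldel i (I ∖ i) (J ∖ i) a) * (1# - q ^ a i)
      ≈ (sgn R ∣ J ∣ * q ^ L I J a) * (q ^ laterSum J a i * (1# - q ^ a i))
  summand-factor q a I J J⊆I i i∈J = begin
      sgn R (∣ J ∖ i ∣ Nat.+ 1) * q ^ (tailSum a i Nat.+ Ldel i (I ∖ i) (J ∖ i) a) * X
    ≈⟨ *-congʳ (*-cong (reflexive (cong (sgn R) (∣remove∣+1 J i i∈J)))
                       (reflexive (cong (q ^_) (shift a I J i i∈J (⊆-lookup J⊆I i i∈J))))) ⟩
      sgn R ∣ J ∣ * q ^ (L I J a Nat.+ laterSum J a i) * X
    ≈⟨ *-congʳ (*-congˡ (^-homo-* q (L I J a) (laterSum J a i))) ⟩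
      sgn R ∣ J ∣ * (q ^ L I J a * q ^ laterSum J a i) * X
    ≈⟨ *-congʳ (≈-sym (*-assoc _ _ _)) ⟩
      sgn R ∣ J ∣ * q ^ L I J a * q ^ laterSum J a i * X
    ≈⟨ *-assoc _ _ _ ⟩
      (sgn R ∣ J ∣ * q ^ L I J a) * (q ^ laterSum J a i * X) ∎
    where
    X : Carrier
    X = 1# - q ^ a i

lemma5p3 : ∀ {c ℓ : Level} (R : CommutativeRing c ℓ) (q : CommutativeRing.Carrier R)
    (n : ℕ) (a : Fin n → ℕ) → (∀ i → 0 < a i)
    → (I J : Subset n) → Nonempty I → Nonempty J → J ⊆ I
    → CommutativeRing._≈_ R (lhs53 R a I J q) (rhs53 R a I J q)
lemma5p3 R q n a _ I J _ _ J⊆I =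
  ≈-trans (sumOver-factor R J _ _ _ (summand-factor R q a I J J⊆I))
          (*-congˡ (telescope R q n J a))
  where open CommutativeRing R using (*-congˡ) renaming (trans to ≈-trans)
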